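{- Let $l\ge3$, $d\ge1$ and $X\subseteq V$. Then there is $f\in W(l,d)$ with $Im(f)=X$ if and only if $L\subseteq X$ or $|X|\le d+1$.
   Context: For $l\ge3$, $d\ge1$, let $V=\{1,\dots,l+d\}$, $L=\{1,\dots,l\}$, $D=\{l+1,\dots,l+d\}$, and let $M(l,d)$ be the pairwise balanced design on $V$ whose blocks are $L$ together with all $\{i,j\}$ with $l+1\le j\le l+d$, $1\le i<j$. A subsystem is a set $F\subseteq V$ such that for all distinct $x,y\in F$ the unique block containing $x,y$ lies in $F$. For a partial function $f$, $Im(f)=f(Dom(f))$ and $f^{ -w}(B)=f^{ -1}(B)\cup(V\setminus Dom(f))$. $W(l,d)$ is the monoid of all partial functions $f:V\to V$ such that $f^{ -w}(F)$ is a subsystem for every subsystem $F$. -}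

module Defs where

open import Data.Nat using (ℕ; _+_; _<_; _≤_)
open import Data.Fin using (Fin; toℕ)
open import Data.Fin.Subset using (Subset; _∈_; _⊆_; ⁅_⁆; _∪_; inside)
open import Data.Vec using (tabulate; lookup)
open import Data.Bool using (Bool; true)
open import Data.Maybe using (Maybe; maybe)
open import Data.Product using (Σ; ∃; _×_)
open import Data.Sum using (_⊎_)
open import Relation.Binary.PropositionalEquality using (_≡_; _≢_)

-- Points: V = Fin (l + d); the paper's point k (1 ≤ k ≤ l+d) is the
-- element with toℕ = k - 1.  So L = {x | toℕ x < l}, D = {x | l ≤ toℕ x}.
Pt : ℕ → ℕ → Set
Pt l d = Fin (l + d)

Lset : (l d : ℕ) → Subset (l + d)
Lset l d = tabulate (λ x → Data.Nat._<ᵇ_ (toℕ x) l)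

IsBlock : (l d : ℕ) → Subset (l + d) → Set
IsBlock l d B =
  (B ≡ Lset l d) ⊎
  (Σ (Pt l d) λ i → Σ (Pt l d) λ j →
     (toℕ i < toℕ j) × (l ≤ toℕ j) × (B ≡ ⁅ i ⁆ ∪ ⁅ j ⁆))

Subsystem : (l d : ℕ) → Subset (l + d) → Set
Subsystem l d F =
  ∀ (x y : Pt l d) → x ∈ F → y ∈ F → x ≢ y →
  ∀ (B : Subset (l + d)) → IsBlock l d B → x ∈ B → y ∈ B → B ⊆ F

PFun : ℕ → ℕ → Set
PFun l d = Pt l d → Maybe (Pt l d)

-- f^{-w}(F) = f^{-1}(F) ∪ (V \ Dom f)
preW : (l d : ℕ) → PFun l d → Subset (l + d) → Subset (l + d)
preW l d f F = tabulate (λ x → maybe (λ y → lookup F y) true (f x))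

InW : (l d : ℕ) → PFun l d → Set
InW l d f = ∀ (F : Subset (l + d)) → Subsystem l d F → Subsystem l d (preW l d f F)

ImIs : (l d : ℕ) → PFun l d → Subset (l + d) → Set
ImIs l d f X = ∀ (x : Pt l d) →
  (x ∈ X → ∃ λ y → f y ≡ Data.Maybe.just x) × ((∃ λ y → f y ≡ Data.Maybe.just x) → x ∈ X)

module Submission where

-- A set F ⊆ V is a subsystem exactly when it is L-closed: once it holds two
-- distinct points of the long block L it holds all of L (a pair block is
-- filled by any two of its points).  So f ∈ W makes f^{-w}(F) L-closed for
-- every subsystem F, and this is the only way membership in W is used.
--
-- If f ∈ W is undefined at a point of L, or identifies two points
-- of L, then L-closedness of f^{-w}({c}) puts all of f(L) into one point c,
-- so the image is covered by c and the d values on D.  Otherwise f is total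
-- and injective on L and maps L into L: if f(a) ∉ L, the pair {f(a), f(b)} is
-- a subsystem receiving a third point of L (l ≥ 3), against injectivity.
-- By pigeonhole f is then onto L.
--
-- If.  For L ⊆ X the partial identity on X works; for |X| ≤ d + 1 a map
-- constant on L and enumerating X along D works.

open import Defs
open import Data.Nat using (ℕ; _+_; _≤_)
open import Data.Fin.Subset using (Subset; _⊆_; ∣_∣)
open import Data.Product using (Σ; _×_)
open import Data.Sum using (_⊎_)
open import Function.Bundles using (_⇔_)

open import Data.Nat using (zero; suc; _<_; s≤s; z≤n)
import Data.Nat.Properties as ℕP
open import Data.Fin using (Fin; zero; suc; toℕ; fromℕ<; _↑ˡ_; _↑ʳ_; splitAt; punchIn; punchOut; _≟_)
open import Data.Fin.Properties
  using (toℕ-injective; toℕ-fromℕ<; toℕ-↑ˡ; toℕ<n; ↑ˡ-injective; splitAt-↑ˡ; splitAt-↑ʳ;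
         splitAt⁻¹-↑ˡ; splitAt⁻¹-↑ʳ; punchInᵢ≢i; punchIn-injective; punchIn-punchOut;
         punchOut-injective; injective⇒≤; any?)
open import Data.Fin.Subset using (_∈_; _∉_; ⁅_⁆; _∪_; ⊥)
open import Data.Fin.Subset.Properties
  using (_∈?_; x∈⁅x⁆; x∈⁅y⁆⇒x≡y; x∈p∪q⁺; x∈p∪q⁻; ∣⊥∣≡0; ∣⁅x⁆∣≡1; p⊆q⇒∣p∣≤∣q∣)
open import Data.Vec using (_∷_; []; tabulate; lookup; here; there)
open import Data.Vec.Properties using (lookup∘tabulate; []=⇒lookup; lookup⇒[]=)
open import Data.Bool using (Bool; true; false)
open import Data.Bool.Properties using (T-≡)
open import Data.Maybe using (Maybe; just; nothing; maybe; fromMaybe)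
open import Data.Maybe.Properties using (just-injective)
open import Data.Product using (_,_; proj₁; proj₂; ∃)
open import Data.Sum using (inj₁; inj₂; [_,_]′)
open import Data.Empty using (⊥-elim)
open import Function using (_∘_; case_of_)
open import Function.Bundles using (mk⇔; Equivalence)
open import Function.Definitions using (Injective)
open import Relation.Nullary using (yes; no; ¬?)
open import Relation.Nullary.Decidable using (_×-dec_)
open import Relation.Binary.PropositionalEquality
  using (_≡_; _≢_; refl; sym; trans; cong; subst)

∈-tabulate⁺ : ∀ {n} (g : Fin n → Bool) {x} → g x ≡ true → x ∈ tabulate g
∈-tabulate⁺ g {x} gx = lookup⇒[]= x (tabulate g) (trans (lookup∘tabulate g x) gx)

∈-tabulate⁻ : ∀ {n} (g : Fin n → Bool) {x} → x ∈ tabulate g → g x ≡ true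
∈-tabulate⁻ g {x} x∈ = trans (sym (lookup∘tabulate g x)) ([]=⇒lookup x∈)

∈-pair : ∀ {n} {i j x : Fin n} → x ∈ ⁅ i ⁆ ∪ ⁅ j ⁆ → x ≡ i ⊎ x ≡ j
∈-pair {i = i} {j} x∈ with x∈p∪q⁻ ⁅ i ⁆ ⁅ j ⁆ x∈
... | inj₁ x∈i = inj₁ (x∈⁅y⁆⇒x≡y i x∈i)
... | inj₂ x∈j = inj₂ (x∈⁅y⁆⇒x≡y j x∈j)

∈-pair⁺ˡ : ∀ {n} (i j : Fin n) → i ∈ ⁅ i ⁆ ∪ ⁅ j ⁆
∈-pair⁺ˡ i j = x∈p∪q⁺ (inj₁ (x∈⁅x⁆ i))

∈-pair⁺ʳ : ∀ {n} (i j : Fin n) → j ∈ ⁅ i ⁆ ∪ ⁅ j ⁆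
∈-pair⁺ʳ i j = x∈p∪q⁺ {p = ⁅ i ⁆} (inj₂ (x∈⁅x⁆ j))

pair-⊆ : ∀ {n} {i j x y : Fin n} {F : Subset n} → x ≢ y →
         x ∈ ⁅ i ⁆ ∪ ⁅ j ⁆ → y ∈ ⁅ i ⁆ ∪ ⁅ j ⁆ → x ∈ F → y ∈ F → ⁅ i ⁆ ∪ ⁅ j ⁆ ⊆ F
pair-⊆ x≢y x∈ y∈ x∈F y∈F z∈ with ∈-pair x∈ | ∈-pair y∈ | ∈-pair z∈
... | inj₁ refl | inj₁ refl | _         = ⊥-elim (x≢y refl)
... | inj₂ refl | inj₂ refl | _         = ⊥-elim (x≢y refl)
... | inj₁ refl | inj₂ refl | inj₁ refl = x∈F
... | inj₁ refl | inj₂ refl | inj₂ refl = y∈F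
... | inj₂ refl | inj₁ refl | inj₁ refl = y∈F
... | inj₂ refl | inj₁ refl | inj₂ refl = x∈F

∣p∪q∣≤∣p∣+∣q∣ : ∀ {n} (p q : Subset n) → ∣ p ∪ q ∣ ≤ ∣ p ∣ + ∣ q ∣
∣p∪q∣≤∣p∣+∣q∣ []          []          = z≤n
∣p∪q∣≤∣p∣+∣q∣ (true ∷ p)  (true ∷ q)  =
  s≤s (ℕP.≤-trans (∣p∪q∣≤∣p∣+∣q∣ p q) (ℕP.+-monoʳ-≤ ∣ p ∣ (ℕP.n≤1+n _)))
∣p∪q∣≤∣p∣+∣q∣ (true ∷ p)  (false ∷ q) = s≤s (∣p∪q∣≤∣p∣+∣q∣ p q)
∣p∪q∣≤∣p∣+∣q∣ (false ∷ p) (true ∷ q)  =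
  ℕP.≤-trans (s≤s (∣p∪q∣≤∣p∣+∣q∣ p q)) (ℕP.≤-reflexive (sym (ℕP.+-suc ∣ p ∣ ∣ q ∣)))
∣p∪q∣≤∣p∣+∣q∣ (false ∷ p) (false ∷ q) = ∣p∪q∣≤∣p∣+∣q∣ p q

image : ∀ {m n} → (Fin m → Fin n) → Subset n
image {zero}  g = ⊥
image {suc m} g = ⁅ g zero ⁆ ∪ image (g ∘ suc)

∈-image : ∀ {m n} (g : Fin m → Fin n) i → g i ∈ image g
∈-image g zero    = x∈p∪q⁺ (inj₁ (x∈⁅x⁆ (g zero)))
∈-image g (suc i) = x∈p∪q⁺ (inj₂ (∈-image (g ∘ suc) i))

∣image∣≤ : ∀ {m n} (g : Fin m → Fin n) → ∣ image g ∣ ≤ m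
∣image∣≤ {zero}  {n} g = ℕP.≤-reflexive (∣⊥∣≡0 n)
∣image∣≤ {suc m} g = begin
  ∣ ⁅ g zero ⁆ ∪ image (g ∘ suc) ∣      ≤⟨ ∣p∪q∣≤∣p∣+∣q∣ ⁅ g zero ⁆ (image (g ∘ suc)) ⟩
  ∣ ⁅ g zero ⁆ ∣ + ∣ image (g ∘ suc) ∣  ≡⟨ cong (_+ ∣ image (g ∘ suc) ∣) (∣⁅x⁆∣≡1 (g zero)) ⟩
  suc ∣ image (g ∘ suc) ∣               ≤⟨ s≤s (∣image∣≤ (g ∘ suc)) ⟩
  suc m                                 ∎
  where open ℕP.≤-Reasoning

enumerate : ∀ {n} (X : Subset n) → Fin ∣ X ∣ → Fin n
enumerate (true ∷ X)  zero    = zero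
enumerate (true ∷ X)  (suc i) = suc (enumerate X i)
enumerate (false ∷ X) i       = suc (enumerate X i)

enumerate-∈ : ∀ {n} (X : Subset n) i → enumerate X i ∈ X
enumerate-∈ (true ∷ X)  zero    = here
enumerate-∈ (true ∷ X)  (suc i) = there (enumerate-∈ X i)
enumerate-∈ (false ∷ X) i       = there (enumerate-∈ X i)

enumerate-onto : ∀ {n} {X : Subset n} {x} → x ∈ X → ∃ λ i → enumerate X i ≡ x
enumerate-onto {X = true ∷ X}  here      = zero , refl
enumerate-onto {X = true ∷ X}  (there p) with enumerate-onto p
... | i , refl = suc i , refl
enumerate-onto {X = false ∷ X} (there p) with enumerate-onto p
... | i , refl = i , refl

pad : ∀ {A : Set} {m n} → (Fin m → A) → m ≤ n → Fin n → Maybe A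
pad e z≤n       k       = nothing
pad e (s≤s m≤n) zero    = just (e zero)
pad e (s≤s m≤n) (suc k) = pad (e ∘ suc) m≤n k

pad-sound : ∀ {A : Set} {m n} (e : Fin m → A) (m≤n : m ≤ n) {k x} →
            pad e m≤n k ≡ just x → ∃ λ i → e i ≡ x
pad-sound e (s≤s m≤n) {zero}  refl = zero , refl
pad-sound e (s≤s m≤n) {suc k} eq with pad-sound (e ∘ suc) m≤n eq
... | i , ei≡x = suc i , ei≡x

pad-complete : ∀ {A : Set} {m n} (e : Fin m → A) (m≤n : m ≤ n) i →
               ∃ λ k → pad e m≤n k ≡ just (e i)
pad-complete e (s≤s m≤n) zero    = zero , refl
pad-complete e (s≤s m≤n) (suc i) with pad-complete (e ∘ suc) m≤n i
... | k , eq = suc k , eq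

undefined-or-total : ∀ {A : Set} {m} (g : Fin m → Maybe A) →
  (∃ λ i → g i ≡ nothing) ⊎ (Σ (Fin m → A) λ h → ∀ i → g i ≡ just (h i))
undefined-or-total {m = zero}  g = inj₂ ((λ ()) , λ ())
undefined-or-total {m = suc m} g with g zero in g0 | undefined-or-total (g ∘ suc)
... | nothing | _              = inj₁ (zero , g0)
... | just v  | inj₁ (i , gi)  = inj₁ (suc i , gi)
... | just v  | inj₂ (h , g≡h) =
  inj₂ ((λ { zero → v ; (suc i) → h i }) , λ { zero → g0 ; (suc i) → g≡h i })

collision-or-injective : ∀ {m n} (h : Fin m → Fin n) →
  (∃ λ i → ∃ λ j → i ≢ j × h i ≡ h j) ⊎ Injective _≡_ _≡_ h
collision-or-injective h with any? (λ i → any? (λ j → ¬? (i ≟ j) ×-dec (h i ≟ h j)))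
... | yes (i , j , i≢j , hi≡hj) = inj₁ (i , j , i≢j , hi≡hj)
... | no none = inj₂ injective
  where
  injective : Injective _≡_ _≡_ h
  injective {i} {j} hi≡hj with i ≟ j
  ... | yes i≡j = i≡j
  ... | no i≢j  = ⊥-elim (none (i , j , i≢j , hi≡hj))

-- Pigeonhole: an injective self-map of a finite set is onto.  If t were
-- missed, h would factor injectively through Fin m, which is too small.
injective⇒onto : ∀ {m} (h : Fin m → Fin m) → Injective _≡_ _≡_ h → ∀ t → ∃ λ i → h i ≡ t
injective⇒onto {suc m} h h-inj t with any? (λ i → h i ≟ t)
... | yes hit = hit
... | no miss = ⊥-elim (ℕP.1+n≰n (injective⇒≤ {f = h′} h′-inj))
  where
  h′ : Fin (suc m) → Fin m
  h′ i = punchOut {i = t} {j = h i} (λ t≡hi → miss (i , sym t≡hi))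
  h′-inj : Injective _≡_ _≡_ h′
  h′-inj eq = h-inj (punchOut-injective {i = t} _ _ eq)

avoid₂ : ∀ {n} → 3 ≤ n → (i j : Fin n) → ∃ λ k → k ≢ i × k ≢ j
avoid₂ {suc (suc (suc n))} (s≤s (s≤s (s≤s _))) i j with i ≟ j
... | yes refl = punchIn i zero , punchInᵢ≢i i zero , punchInᵢ≢i i zero
... | no i≢j   = punchIn i (punchIn j′ zero) , punchInᵢ≢i i _ , k≢j
  where
  -- j = punchIn i j′, and punchIn j′ zero ≢ j′
  j′ : Fin (suc (suc n))
  j′ = punchOut i≢j
  k≢j : punchIn i (punchIn j′ zero) ≢ j
  k≢j k≡j = punchInᵢ≢i j′ zero
    (punchIn-injective i _ _ (trans k≡j (sym (punchIn-punchOut i≢j))))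

module Design (l d : ℕ) where

  V : Set
  V = Pt l d

  L : Subset (l + d)
  L = Lset l d

  ι : Fin l → V
  ι i = i ↑ˡ d

  ι∈L : ∀ i → ι i ∈ L
  ι∈L i = ∈-tabulate⁺ _ (Equivalence.to T-≡ (ℕP.<⇒<ᵇ (subst (_< l) (sym (toℕ-↑ˡ i d)) (toℕ<n i))))

  ∈L⇒ι : ∀ {x} → x ∈ L → ∃ λ i → ι i ≡ x
  ∈L⇒ι {x} x∈L = fromℕ< x<l , toℕ-injective (trans (toℕ-↑ˡ (fromℕ< x<l) d) (toℕ-fromℕ< x<l))
    where
    x<l : toℕ x < l
    x<l = ℕP.<ᵇ⇒< (toℕ x) l (Equivalence.from T-≡ (∈-tabulate⁻ _ x∈L))

  point-cases : ∀ y → (∃ λ i → ι i ≡ y) ⊎ (∃ λ k → l ↑ʳ k ≡ y)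
  point-cases y with splitAt l y in eq
  ... | inj₁ i = inj₁ (i , splitAt⁻¹-↑ˡ eq)
  ... | inj₂ k = inj₂ (k , splitAt⁻¹-↑ʳ eq)

  LClosed : Subset (l + d) → Set
  LClosed F = ∀ {a b} → a ∈ F → b ∈ F → a ≢ b → a ∈ L → b ∈ L → L ⊆ F

  subsystem⇒LClosed : ∀ {F} → Subsystem l d F → LClosed F
  subsystem⇒LClosed S a∈F b∈F a≢b a∈L b∈L = S _ _ a∈F b∈F a≢b L (inj₁ refl) a∈L b∈L

  LClosed⇒subsystem : ∀ {F} → LClosed F → Subsystem l d F
  LClosed⇒subsystem closed x y x∈F y∈F x≢y B (inj₁ refl) x∈L y∈L = closed x∈F y∈F x≢y x∈L y∈L
  LClosed⇒subsystem closed x y x∈F y∈F x≢y B (inj₂ (i , j , _ , _ , refl)) x∈B y∈B =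
    pair-⊆ x≢y x∈B y∈B x∈F y∈F

  ⁅⁆-subsystem : ∀ c → Subsystem l d ⁅ c ⁆
  ⁅⁆-subsystem c = LClosed⇒subsystem λ a∈ b∈ a≢b _ _ →
    ⊥-elim (a≢b (trans (x∈⁅y⁆⇒x≡y c a∈) (sym (x∈⁅y⁆⇒x≡y c b∈))))

  -- A pair with a point outside L meets L in at most one point.
  pair-subsystem : ∀ {u} w → u ∉ L → Subsystem l d (⁅ u ⁆ ∪ ⁅ w ⁆)
  pair-subsystem {u} w u∉L = LClosed⇒subsystem closed
    where
    closed : LClosed (⁅ u ⁆ ∪ ⁅ w ⁆)
    closed a∈ b∈ a≢b a∈L b∈L with ∈-pair a∈ | ∈-pair b∈
    ... | inj₁ refl | _         = ⊥-elim (u∉L a∈L)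
    ... | inj₂ _    | inj₁ refl = ⊥-elim (u∉L b∈L)
    ... | inj₂ refl | inj₂ refl = ⊥-elim (a≢b refl)

  ∈preW⁺ : ∀ (f : PFun l d) {F x} → (∀ {v} → f x ≡ just v → v ∈ F) → x ∈ preW l d f F
  ∈preW⁺ f {F} {x} values∈F = ∈-tabulate⁺ _ (allowed (f x) values∈F)
    where
    allowed : ∀ m → (∀ {v} → m ≡ just v → v ∈ F) → maybe (λ y → lookup F y) true m ≡ true
    allowed nothing  _   = refl
    allowed (just v) v∈F = []=⇒lookup (v∈F refl)

  ∈preW⁻ : ∀ (f : PFun l d) {F x v} → x ∈ preW l d f F → f x ≡ just v → v ∈ F
  ∈preW⁻ f {F} {x} {v} x∈ fx≡v = lookup⇒[]= v F
    (subst (λ m → maybe (λ y → lookup F y) true m ≡ true) fx≡v (∈-tabulate⁻ _ x∈))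

  ∈preW-just : ∀ (f : PFun l d) {F x v} → f x ≡ just v → v ∈ F → x ∈ preW l d f F
  ∈preW-just f fx≡v v∈F = ∈preW⁺ f λ fx≡w → subst (_∈ _) (just-injective (trans (sym fx≡v) fx≡w)) v∈F

  ∈preW-value : ∀ (f : PFun l d) y → y ∈ preW l d f ⁅ fromMaybe y (f y) ⁆
  ∈preW-value f y = ∈preW⁺ f λ {v} fy≡v → subst (λ m → v ∈ ⁅ fromMaybe y m ⁆) (sym fy≡v) (x∈⁅x⁆ v)

  spread : ∀ (f : PFun l d) {F} → InW l d f → Subsystem l d F → ∀ {i j} → i ≢ j →
           ι i ∈ preW l d f F → ι j ∈ preW l d f F → ∀ k → ι k ∈ preW l d f F
  spread f {F} W S i≢j ιi∈ ιj∈ k =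
    subsystem⇒LClosed (W F S) ιi∈ ιj∈ (i≢j ∘ ↑ˡ-injective d _ _) (ι∈L _) (ι∈L _) (ι∈L k)

  constant⇒InW : ∀ {f : PFun l d} → (∀ {a z} → a ∈ L → z ∈ L → f z ≡ f a) → InW l d f
  constant⇒InW {f} constant F S = LClosed⇒subsystem λ a∈ _ _ a∈L _ z∈L →
    ∈preW⁺ f {F} λ fz≡v → ∈preW⁻ f {F} a∈ (trans (sym (constant a∈L z∈L)) fz≡v)

  -- The quotient of V collapsing L to one point: L ↦ 0, l ↑ʳ k ↦ 1 + k.
  κ : V → Fin (suc d)
  κ y = [ (λ _ → zero) , suc ]′ (splitAt l y)

  κ-ι : ∀ i → κ (ι i) ≡ zero
  κ-ι i = cong [ (λ _ → zero) , suc ]′ (splitAt-↑ˡ l i d)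

  κ-↑ʳ : ∀ k → κ (l ↑ʳ k) ≡ suc k
  κ-↑ʳ k = cong [ (λ _ → zero) , suc ]′ (splitAt-↑ʳ l d k)

  κ-onto : Fin l → ∀ k → ∃ λ y → κ y ≡ k
  κ-onto i zero    = ι i , κ-ι i
  κ-onto i (suc k) = l ↑ʳ k , κ-↑ʳ k

  Collapses : PFun l d → V → Set
  Collapses f c = ∀ i → ι i ∈ preW l d f ⁅ c ⁆

  -- A collapsing map is determined on its domain by c and its values on D.
  collapsedValue : PFun l d → V → Fin (suc d) → V
  collapsedValue f c zero    = c
  collapsedValue f c (suc k) = fromMaybe c (f (l ↑ʳ k))

  collapsed-factor : ∀ {f c y x} → Collapses f c → f y ≡ just x → collapsedValue f c (κ y) ≡ x
  collapsed-factor {f} {c} {y} collapses fy≡x with point-cases y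
  ... | inj₁ (i , refl) rewrite κ-ι i = sym (x∈⁅y⁆⇒x≡y c (∈preW⁻ f (collapses i) fy≡x))
  ... | inj₂ (k , refl) rewrite κ-↑ʳ k | fy≡x = refl

  collapse-bound : ∀ {f X} → Σ V (Collapses f) → ImIs l d f X → ∣ X ∣ ≤ d + 1
  collapse-bound {f} {X} (c , collapses) im = begin
    ∣ X ∣                          ≤⟨ p⊆q⇒∣p∣≤∣q∣ X⊆image ⟩
    ∣ image (collapsedValue f c) ∣ ≤⟨ ∣image∣≤ (collapsedValue f c) ⟩
    suc d                          ≡⟨ ℕP.+-comm 1 d ⟩
    d + 1                          ∎
    where
    open ℕP.≤-Reasoning
    X⊆image : X ⊆ image (collapsedValue f c)
    X⊆image {x} x∈X with proj₁ (im x) x∈X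
    ... | y , fy≡x =
      subst (_∈ _) (collapsed-factor {f} {c} collapses fy≡x) (∈-image (collapsedValue f c) (κ y))

  undefined⇒collapse : 3 ≤ l → ∀ {f i} → InW l d f → f (ι i) ≡ nothing → Σ V (Collapses f)
  undefined⇒collapse h3 {f} {i} W fιi≡nothing with avoid₂ h3 i i
  ... | j , j≢i , _ = c , spread f W (⁅⁆-subsystem c) (j≢i ∘ sym) ιi∈ (∈preW-value f (ι j))
    where
    c = fromMaybe (ι j) (f (ι j))
    ιi∈ : ι i ∈ preW l d f ⁅ c ⁆
    ιi∈ = ∈preW⁺ f {⁅ c ⁆} λ fιi≡v → case trans (sym fιi≡nothing) fιi≡v of λ ()

  collision⇒collapse : ∀ {f i j c} → InW l d f → i ≢ j →
                       f (ι i) ≡ just c → f (ι j) ≡ just c → Collapses f c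
  collision⇒collapse {f} {c = c} W i≢j fιi≡c fιj≡c =
    spread f W (⁅⁆-subsystem c) i≢j (∈preW-just f fιi≡c (x∈⁅x⁆ c)) (∈preW-just f fιj≡c (x∈⁅x⁆ c))

  module InjectiveOnL (h3 : 3 ≤ l) {f : PFun l d} (W : InW l d f)
         (h : Fin l → V) (f∘ι≡h : ∀ i → f (ι i) ≡ just (h i)) (h-inj : Injective _≡_ _≡_ h) where

    images-in-pair : ∀ {i j} → h i ∉ L → j ≢ i → ∀ k → h k ∈ ⁅ h i ⁆ ∪ ⁅ h j ⁆
    images-in-pair {i} {j} hi∉L j≢i k = ∈preW⁻ f ιk∈ (f∘ι≡h k)
      where
      ιk∈ : ι k ∈ preW l d f (⁅ h i ⁆ ∪ ⁅ h j ⁆)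
      ιk∈ = spread f W (pair-subsystem (h j) hi∉L) (j≢i ∘ sym)
        (∈preW-just f (f∘ι≡h i) (∈-pair⁺ˡ (h i) (h j)))
        (∈preW-just f (f∘ι≡h j) (∈-pair⁺ʳ (h i) (h j))) k

    -- Hence h i ∈ L: otherwise a third point k would collide with i or j.
    h-into-L : ∀ i → h i ∈ L
    h-into-L i with h i ∈? L
    ... | yes hi∈L = hi∈L
    ... | no hi∉L with avoid₂ h3 i i
    ...   | j , j≢i , _ with avoid₂ h3 i j
    ...     | k , k≢i , k≢j with ∈-pair (images-in-pair hi∉L j≢i k)
    ...       | inj₁ hk≡hi = ⊥-elim (k≢i (h-inj hk≡hi))
    ...       | inj₂ hk≡hj = ⊥-elim (k≢j (h-inj hk≡hj))

    h↾ : Fin l → Fin l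
    h↾ i = proj₁ (∈L⇒ι (h-into-L i))

    ι∘h↾ : ∀ i → ι (h↾ i) ≡ h i
    ι∘h↾ i = proj₂ (∈L⇒ι (h-into-L i))

    h↾-inj : Injective _≡_ _≡_ h↾
    h↾-inj {i} {j} eq = h-inj (trans (sym (ι∘h↾ i)) (trans (cong ι eq) (ι∘h↾ j)))

    L⊆image : ∀ {X} → ImIs l d f X → L ⊆ X
    L⊆image im {t} t∈L with ∈L⇒ι t∈L
    ... | s , refl with injective⇒onto h↾ h↾-inj s
    ...   | i , h↾i≡s = proj₂ (im (ι s)) (ι i , trans (f∘ι≡h i) (cong just hi≡ιs))
      where
      hi≡ιs : h i ≡ ι s
      hi≡ιs = trans (sym (ι∘h↾ i)) (cong ι h↾i≡s)

  image-of-W : 3 ≤ l → ∀ {X} → (Σ (PFun l d) λ f → InW l d f × ImIs l d f X) →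
               L ⊆ X ⊎ ∣ X ∣ ≤ d + 1
  image-of-W h3 (f , W , im) with undefined-or-total (f ∘ ι)
  ... | inj₁ (i , undefined) = inj₂ (collapse-bound {f} (undefined⇒collapse h3 {f} W undefined) im)
  ... | inj₂ (h , f∘ι≡h) with collision-or-injective h
  ...   | inj₁ (i , j , i≢j , hi≡hj) = inj₂ (collapse-bound {f} (h i , collapses) im)
    where
    collapses : Collapses f (h i)
    collapses = collision⇒collapse {f} W i≢j (f∘ι≡h i) (trans (f∘ι≡h j) (cong just (sym hi≡hj)))
  ...   | inj₂ h-inj = inj₁ (InjectiveOnL.L⊆image h3 W h f∘ι≡h h-inj im)

  restrict : Subset (l + d) → PFun l d
  restrict X y with y ∈? X
  ... | yes _ = just y
  ... | no _  = nothing

  restrict-∈ : ∀ {X y} → y ∈ X → restrict X y ≡ just y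
  restrict-∈ {X} {y} y∈X with y ∈? X
  ... | yes _   = refl
  ... | no y∉X  = ⊥-elim (y∉X y∈X)

  restrict-image : ∀ X → ImIs l d (restrict X) X
  restrict-image X x = (λ x∈X → x , restrict-∈ x∈X) , λ { (y , eq) → fixed y eq }
    where
    fixed : ∀ y → restrict X y ≡ just x → x ∈ X
    fixed y eq with y ∈? X
    fixed y refl | yes y∈X = y∈X

  -- With L ⊆ X, f^{-w}(F) agrees with F on L.
  restrict-InW : ∀ {X} → L ⊆ X → InW l d (restrict X)
  restrict-InW {X} L⊆X F S = LClosed⇒subsystem λ a∈ b∈ a≢b a∈L b∈L z∈L →
    ∈preW-just (restrict X) (restrict-∈ (L⊆X z∈L))
      (subsystem⇒LClosed S (back a∈ a∈L) (back b∈ b∈L) a≢b a∈L b∈L z∈L)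
    where
    back : ∀ {a} → a ∈ preW l d (restrict X) F → a ∈ L → a ∈ F
    back a∈ a∈L = ∈preW⁻ (restrict X) a∈ (restrict-∈ (L⊆X a∈L))

  -- If, second case: L ↦ first element of X, and the points of D onto the
  -- remaining elements; being constant on L it lies in W.
  squeeze : (X : Subset (l + d)) → ∣ X ∣ ≤ suc d → PFun l d
  squeeze X bound y = pad (enumerate X) bound (κ y)

  squeeze-InW : ∀ X bound → InW l d (squeeze X bound)
  squeeze-InW X bound = constant⇒InW λ a∈L z∈L →
    cong (pad (enumerate X) bound) (trans (κ-L z∈L) (sym (κ-L a∈L)))
    where
    κ-L : ∀ {z} → z ∈ L → κ z ≡ zero
    κ-L z∈L with ∈L⇒ι z∈L
    ... | i , refl = κ-ι i

  -- Its image is X, as κ is onto (L is nonempty) and pad lists all of X.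
  squeeze-image : Fin l → ∀ X bound → ImIs l d (squeeze X bound) X
  squeeze-image i₀ X bound x = hit , λ { (y , eq) → sound y eq }
    where
    hit : x ∈ X → ∃ λ y → squeeze X bound y ≡ just x
    hit x∈X with enumerate-onto x∈X
    ... | i , refl with pad-complete (enumerate X) bound i
    ...   | k , eq with κ-onto i₀ k
    ...     | y , refl = y , eq
    sound : ∀ y → squeeze X bound y ≡ just x → x ∈ X
    sound y eq with pad-sound (enumerate X) bound eq
    ... | i , refl = enumerate-∈ X i

corollary9p3 : (l d : ℕ) → 3 ≤ l → 1 ≤ d → (X : Subset (l + d)) →
    (Σ (PFun l d) λ f → InW l d f × ImIs l d f X) ⇔ (Lset l d ⊆ X ⊎ ∣ X ∣ ≤ d + 1)
corollary9p3 l d h3 _ X = mk⇔ (image-of-W h3) realise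
  where
  open Design l d
  realise : L ⊆ X ⊎ ∣ X ∣ ≤ d + 1 → Σ (PFun l d) λ f → InW l d f × ImIs l d f X
  realise (inj₁ L⊆X) = restrict X , restrict-InW L⊆X , restrict-image X
  -- fromℕ< h3 is the third point of L, witnessing L ≠ ∅.
  realise (inj₂ bound) = squeeze X bound′ , squeeze-InW X bound′ , squeeze-image (fromℕ< h3) X bound′
    where
    bound′ : ∣ X ∣ ≤ suc d
    bound′ = subst (∣ X ∣ ≤_) (ℕP.+-comm d 1) bound
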